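{- Let $x$ be any finite word over $\Sigma_3=\{0,1,2\}$ with $|x|\geq 4$. Then there exists an infinite squarefree word over $\Sigma_3$ that contains no occurrence of $x$.
   Context: $|x|$ denotes the length of the word $x$. An infinite word over an alphabet $\Sigma$ is a right-infinite sequence $w=w_1w_2w_3\cdots$ of letters of $\Sigma$. A word $u$ occurs in $w$ (is a subword of $w$) if $u$ appears as a block of consecutive letters of $w$. A square is a word of the form $yy$ with $y$ a nonempty word; a word is squarefree if none of its subwords is a square. -}

module Defs where

open import Data.Nat using (ℕ; zero; suc; _+_; _<_; _≥_)
open import Data.Fin using (Fin)
open import Data.List using (List; length; lookup)
open import Data.Product using (∃; Σ; _×_)
open import Relation.Binary.PropositionalEquality using (_≡_)
open import Relation.Nullary using (¬_)

Σ₃ : Set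
Σ₃ = Fin 3

InfWord : Set → Set
InfWord A = ℕ → A

OccursAt : {A : Set} → List A → InfWord A → ℕ → Set
OccursAt u w i = (j : Fin (length u)) → w (i + Data.Fin.toℕ j) ≡ lookup u j

Occurs : {A : Set} → List A → InfWord A → Set
Occurs u w = ∃ λ i → OccursAt u w i

SquareAt : {A : Set} → InfWord A → ℕ → ℕ → Set
SquareAt w i n = (0 < n) × ((j : ℕ) → j < n → w (i + j) ≡ w (i + n + j))

Squarefree : {A : Set} → InfWord A → Set
Squarefree w = (i n : ℕ) → ¬ SquareAt w i n

-- Let t be the Thue–Morse word and vtm = Δ t the word of its steps t(n+1) − t(n) + 1 over
-- {0,1,2}.  A square of period n in Δ t forces t(i+j) = t(i+n+j) for all j ≤ n, an overlap of t.
-- There is none: across an overlap of odd period t would have to alternate, and one of even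
-- period 2m yields an overlap of period m at ⌊i/2⌋.  So vtm is squarefree.  It also avoids a1a,
-- since in any Δ t such a factor forces a = 1, and 1ab1, since the letter 1 (a stutter of t) only
-- occurs at odd positions.  Two of the first four letters of x coincide, at positions i < j, and
-- in each case there is a position k such that no factor of vtm has equal letters at i and j and
-- the letter 1 at k.  Renaming the letters of vtm by the transposition that sends 1 to x_k yields
-- a squarefree word avoiding x.
module Submission where

open import Defs
open import Data.Fin as Fin using (Fin; toℕ; inject≤)
open import Data.Fin.Patterns using (0F; 1F; 2F; 3F)
open import Data.Fin.Permutation using (Permutation′; _⟨$⟩ʳ_; transpose)
open import Data.Fin.Properties using (pigeonhole; toℕ-inject≤)
open import Data.List using (List; length; lookup)
open import Data.Nat using (ℕ; zero; suc; _+_; _≤_; _<_; _≥_; z≤n; s≤s; s≤s⁻¹; z<s; ⌊_/2⌋; parity)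
open import Data.Nat.Induction using (<-rec)
open import Data.Nat.Properties
  using (+-suc; +-identityʳ; +-comm; +-mono-≤; ≤-refl; ≤-trans; <⇒≤; n≤1+n; n<1+n; n≮0; m<m+n;
         ⌊n/2⌋≤n; ⌊n/2⌋<n; n≡⌊n+n/2⌋; n≡⌈n+n/2⌉; +-commutativeSemigroup)
open import Algebra.Properties.CommutativeSemigroup +-commutativeSemigroup using (xy∙z≈xz∙y)
open import Data.Parity using (Parity; 0ℙ; 1ℙ; _⁻¹)
import Data.Parity as ℙ
open import Data.Parity.Properties using (p≢p⁻¹; p+p≡0ℙ; +-homo-+; suc-homo-⁻¹; +-cancelˡ-≡)
  renaming (+-identityʳ to ℙ-+-identityʳ; +-assoc to ℙ-+-assoc)
open import Data.Product using (∃; _×_; _,_)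
open import Data.Sum using (_⊎_; inj₁; inj₂)
open import Function using (_∘_; Injective; Injection)
open import Function.Properties.Inverse using (↔⇒↣)
open import Relation.Nullary using (¬_; contradiction)
open import Relation.Binary.PropositionalEquality
  using (_≡_; _≢_; refl; sym; trans; cong; cong₂; module ≡-Reasoning)

private
  variable
    A B : Set

squarefree-map : {f : A → B} {w : InfWord A} →
  Injective _≡_ _≡_ f → Squarefree w → Squarefree (f ∘ w)
squarefree-map f-injective w-squarefree i n (n>0 , halves≡) =
  w-squarefree i n (n>0 , λ j j<n → f-injective (halves≡ j j<n))

squarefree⇒≢suc : {w : InfWord A} → Squarefree w → ∀ p → w p ≢ w (suc p)
squarefree⇒≢suc {w = w} w-squarefree p wₚ≡wₚ₊₁ =
  w-squarefree p 1 (z<s , λ { zero _ → letters≡ ; (suc _) (s≤s ()) })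
  where
  open ≡-Reasoning
  letters≡ : w (p + 0) ≡ w (p + 1 + 0)
  letters≡ = begin
    w (p + 0)     ≡⟨ cong w (+-identityʳ p) ⟩
    w p           ≡⟨ wₚ≡wₚ₊₁ ⟩
    w (1 + p)     ≡⟨ cong w (+-comm 1 p) ⟩
    w (p + 1)     ≡⟨ cong w (sym (+-identityʳ (p + 1))) ⟩
    w (p + 1 + 0) ∎

even-or-odd : ∀ n → ∃ λ k → n ≡ k + k ⊎ n ≡ suc (k + k)
even-or-odd zero = zero , inj₁ refl
even-or-odd (suc n) with even-or-odd n
... | k , inj₁ n≡2k   = k , inj₂ (cong suc n≡2k)
... | k , inj₂ n≡2k+1 = suc k , inj₁ (trans (cong suc n≡2k+1) (sym (cong suc (+-suc k k))))

⌊m+[n+n]/2⌋≡⌊m/2⌋+n : ∀ m n → ⌊ m + (n + n) /2⌋ ≡ ⌊ m /2⌋ + n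
⌊m+[n+n]/2⌋≡⌊m/2⌋+n zero          n = sym (n≡⌊n+n/2⌋ n)
⌊m+[n+n]/2⌋≡⌊m/2⌋+n (suc zero)    n = sym (n≡⌈n+n/2⌉ n)
⌊m+[n+n]/2⌋≡⌊m/2⌋+n (suc (suc m)) n = cong suc (⌊m+[n+n]/2⌋≡⌊m/2⌋+n m n)

parity[m+[n+n]]≡parity[m] : ∀ m n → parity (m + (n + n)) ≡ parity m
parity[m+[n+n]]≡parity[m] m n = begin
  parity (m + (n + n))            ≡⟨ +-homo-+ m (n + n) ⟩
  parity m ℙ.+ parity (n + n)     ≡⟨ cong (parity m ℙ.+_) (trans (+-homo-+ n n) (p+p≡0ℙ (parity n))) ⟩
  parity m ℙ.+ 0ℙ                 ≡⟨ ℙ-+-identityʳ (parity m) ⟩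
  parity m                        ∎
  where open ≡-Reasoning

parity[n]⊎parity[1+n]≡0ℙ : ∀ n → parity n ≡ 0ℙ ⊎ parity (suc n) ≡ 0ℙ
parity[n]⊎parity[1+n]≡0ℙ zero          = inj₁ refl
parity[n]⊎parity[1+n]≡0ℙ (suc zero)    = inj₂ refl
parity[n]⊎parity[1+n]≡0ℙ (suc (suc n)) = parity[n]⊎parity[1+n]≡0ℙ n

n≤1+m⇒⌊n/2⌋≤m : ∀ {m n} → n ≤ suc m → ⌊ n /2⌋ ≤ m
n≤1+m⇒⌊n/2⌋≤m {n = zero}  _           = z≤n
n≤1+m⇒⌊n/2⌋≤m {n = suc n} (s≤s n≤m) = ≤-trans (s≤s⁻¹ (⌊n/2⌋<n n)) n≤m

-- thueMorseᶠ f n is the parity of the binary digit sum of n, provided the fuel f is at least n.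
thueMorseᶠ : ℕ → ℕ → Parity
thueMorseᶠ zero    _ = 0ℙ
thueMorseᶠ (suc f) n = parity n ℙ.+ thueMorseᶠ f ⌊ n /2⌋

thueMorse : InfWord Parity
thueMorse n = thueMorseᶠ n n

thueMorseᶠ-fuel : ∀ {f g n} → n ≤ f → n ≤ g → thueMorseᶠ f n ≡ thueMorseᶠ g n
thueMorseᶠ-fuel {zero}  {zero}  _   _   = refl
thueMorseᶠ-fuel {zero}  {suc g} z≤n _   = thueMorseᶠ-fuel {zero} {g} z≤n z≤n
thueMorseᶠ-fuel {suc f} {zero}  _   z≤n = thueMorseᶠ-fuel {f} {zero} z≤n z≤n
thueMorseᶠ-fuel {suc f} {suc g} {n} n≤1+f n≤1+g =
  cong (parity n ℙ.+_) (thueMorseᶠ-fuel (n≤1+m⇒⌊n/2⌋≤m n≤1+f) (n≤1+m⇒⌊n/2⌋≤m n≤1+g))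

thueMorse-unfold : ∀ n → thueMorse n ≡ parity n ℙ.+ thueMorse ⌊ n /2⌋
thueMorse-unfold n = trans (thueMorseᶠ-fuel ≤-refl (n≤1+n n))
                           (cong (parity n ℙ.+_) (thueMorseᶠ-fuel (⌊n/2⌋≤n n) ≤-refl))

thueMorse-+-double : ∀ m k → thueMorse (m + (k + k)) ≡ parity m ℙ.+ thueMorse (⌊ m /2⌋ + k)
thueMorse-+-double m k =
  trans (thueMorse-unfold (m + (k + k)))
        (cong₂ (λ p q → p ℙ.+ thueMorse q) (parity[m+[n+n]]≡parity[m] m k) (⌊m+[n+n]/2⌋≡⌊m/2⌋+n m k))

thueMorse-flip : ∀ q → parity q ≡ 0ℙ → thueMorse (suc q) ≡ thueMorse q ⁻¹
thueMorse-flip q q-even with even-or-odd q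
... | k , inj₁ refl = trans (thueMorse-+-double 1 k) (cong _⁻¹ (sym (thueMorse-+-double 0 k)))
... | k , inj₂ refl = contradiction (trans (sym (parity[m+[n+n]]≡parity[m] 1 k)) q-even) λ ()

Overlap : InfWord A → ℕ → ℕ → Set
Overlap w i n = ∀ j → j ≤ n → w (i + j) ≡ w (i + n + j)

alternating⇒parity : ∀ (t : InfWord Parity) i n →
  (∀ j → j < n → t (i + suc j) ≡ t (i + j) ⁻¹) → ∀ j → j ≤ n → t (i + j) ≡ parity j ℙ.+ t i
alternating⇒parity t i n alternates zero    _   = cong t (+-identityʳ i)
alternating⇒parity t i n alternates (suc j) j<n = begin
  t (i + suc j)                 ≡⟨ alternates j j<n ⟩
  t (i + j) ⁻¹                  ≡⟨ cong _⁻¹ (alternating⇒parity t i n alternates j (<⇒≤ j<n)) ⟩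
  (parity j ℙ.+ t i) ⁻¹         ≡⟨ sym (ℙ-+-assoc 1ℙ (parity j) (t i)) ⟩
  parity j ⁻¹ ℙ.+ t i           ≡⟨ cong (ℙ._+ t i) (suc-homo-⁻¹ (suc j)) ⟩
  parity (suc j) ℙ.+ t i        ∎
  where open ≡-Reasoning

-- Every step of t from i to i + n is a flip: of q and q + n one is even, and the overlap transports
-- the flip at the even one.
overlap-odd-period : ∀ i m → ¬ Overlap thueMorse i (suc (m + m))
overlap-odd-period i m ov = p≢p⁻¹ (thueMorse i) (begin
  thueMorse i                   ≡⟨ cong thueMorse (sym (+-identityʳ i)) ⟩
  thueMorse (i + 0)             ≡⟨ ov 0 z≤n ⟩
  thueMorse (i + n + 0)         ≡⟨ cong thueMorse (+-identityʳ (i + n)) ⟩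
  thueMorse (i + n)             ≡⟨ alternating⇒parity thueMorse i n alternates n ≤-refl ⟩
  parity n ℙ.+ thueMorse i      ≡⟨ cong (ℙ._+ thueMorse i) (parity[m+[n+n]]≡parity[m] 1 m) ⟩
  thueMorse i ⁻¹                ∎)
  where
  open ≡-Reasoning
  n = suc (m + m)
  alternates : ∀ j → j < n → thueMorse (i + suc j) ≡ thueMorse (i + j) ⁻¹
  alternates j j<n with parity (i + j) in i+j-parity
  ... | 0ℙ = trans (cong thueMorse (+-suc i j)) (thueMorse-flip (i + j) i+j-parity)
  ... | 1ℙ = begin
    thueMorse (i + suc j)         ≡⟨ ov (suc j) j<n ⟩
    thueMorse (i + n + suc j)     ≡⟨ cong thueMorse (+-suc (i + n) j) ⟩
    thueMorse (suc (i + n + j))   ≡⟨ thueMorse-flip (i + n + j) i+n+j-even ⟩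
    thueMorse (i + n + j) ⁻¹      ≡⟨ cong _⁻¹ (sym (ov j (<⇒≤ j<n))) ⟩
    thueMorse (i + j) ⁻¹          ∎
    where
    i+n+j-even : parity (i + n + j) ≡ 0ℙ
    i+n+j-even = begin
      parity (i + n + j)                ≡⟨ cong parity (xy∙z≈xz∙y i n j) ⟩
      parity (i + j + n)                ≡⟨ +-homo-+ (i + j) n ⟩
      parity (i + j) ℙ.+ parity n       ≡⟨ cong₂ ℙ._+_ i+j-parity (parity[m+[n+n]]≡parity[m] 1 m) ⟩
      0ℙ                                ∎

overlap-half : ∀ i m → Overlap thueMorse i (m + m) → Overlap thueMorse ⌊ i /2⌋ m
overlap-half i m ov k k≤m = +-cancelˡ-≡ (parity i) _ _ (begin
  parity i ℙ.+ thueMorse (⌊ i /2⌋ + k)                        ≡⟨ sym (thueMorse-+-double i k) ⟩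
  thueMorse (i + (k + k))                                      ≡⟨ ov (k + k) (+-mono-≤ k≤m k≤m) ⟩
  thueMorse (i + (m + m) + (k + k))                            ≡⟨ thueMorse-+-double (i + (m + m)) k ⟩
  parity (i + (m + m)) ℙ.+ thueMorse (⌊ i + (m + m) /2⌋ + k)  ≡⟨ cong₂ (λ p q → p ℙ.+ thueMorse (q + k))
                                                                        (parity[m+[n+n]]≡parity[m] i m)
                                                                        (⌊m+[n+n]/2⌋≡⌊m/2⌋+n i m) ⟩
  parity i ℙ.+ thueMorse (⌊ i /2⌋ + m + k)                    ∎)
  where open ≡-Reasoning

thueMorse-overlapFree : ∀ n → 0 < n → ∀ i → ¬ Overlap thueMorse i n
thueMorse-overlapFree = <-rec _ step
  where
  step : ∀ n → (∀ {m} → m < n → 0 < m → ∀ i → ¬ Overlap thueMorse i m) →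
         0 < n → ∀ i → ¬ Overlap thueMorse i n
  step n shorter n>0 i ov with even-or-odd n
  ... | m     , inj₂ refl = overlap-odd-period i m ov
  ... | zero  , inj₁ refl = n≮0 n>0
  ... | suc m , inj₁ refl = shorter (m<m+n (suc m) z<s) z<s ⌊ i /2⌋ (overlap-half i (suc m) ov)

-- difference a b = b − a + 1, reading parities as 0 and 1
difference : Parity → Parity → Σ₃
difference 0ℙ 0ℙ = 1F
difference 1ℙ 1ℙ = 1F
difference 0ℙ 1ℙ = 2F
difference 1ℙ 0ℙ = 0F

difference-refl : ∀ a → difference a a ≡ 1F
difference-refl 0ℙ = refl
difference-refl 1ℙ = refl

difference≡1⇒≡ : ∀ {a b} → difference a b ≡ 1F → a ≡ b
difference≡1⇒≡ {0ℙ} {0ℙ} _ = refl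
difference≡1⇒≡ {1ℙ} {1ℙ} _ = refl
difference≡1⇒≡ {0ℙ} {1ℙ} ()
difference≡1⇒≡ {1ℙ} {0ℙ} ()

difference-swap : ∀ {a b c d} → difference a b ≡ difference c d → difference a c ≡ difference b d
difference-swap {0ℙ} {0ℙ} {0ℙ} {0ℙ} _  = refl
difference-swap {0ℙ} {0ℙ} {1ℙ} {1ℙ} _  = refl
difference-swap {1ℙ} {1ℙ} {0ℙ} {0ℙ} _  = refl
difference-swap {1ℙ} {1ℙ} {1ℙ} {1ℙ} _  = refl
difference-swap {0ℙ} {1ℙ} {0ℙ} {1ℙ} _  = refl
difference-swap {1ℙ} {0ℙ} {1ℙ} {0ℙ} _  = refl
difference-swap {0ℙ} {0ℙ} {0ℙ} {1ℙ} ()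
difference-swap {0ℙ} {0ℙ} {1ℙ} {0ℙ} ()
difference-swap {0ℙ} {1ℙ} {0ℙ} {0ℙ} ()
difference-swap {0ℙ} {1ℙ} {1ℙ} {0ℙ} ()
difference-swap {0ℙ} {1ℙ} {1ℙ} {1ℙ} ()
difference-swap {1ℙ} {0ℙ} {0ℙ} {0ℙ} ()
difference-swap {1ℙ} {0ℙ} {0ℙ} {1ℙ} ()
difference-swap {1ℙ} {0ℙ} {1ℙ} {1ℙ} ()
difference-swap {1ℙ} {1ℙ} {0ℙ} {1ℙ} ()
difference-swap {1ℙ} {1ℙ} {1ℙ} {0ℙ} ()

difference[a,b]≡difference[b,c]⇒a≡b : ∀ {a b c} → difference a b ≡ difference b c → a ≡ b
difference[a,b]≡difference[b,c]⇒a≡b {0ℙ} {0ℙ} _ = refl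
difference[a,b]≡difference[b,c]⇒a≡b {1ℙ} {1ℙ} _ = refl
difference[a,b]≡difference[b,c]⇒a≡b {0ℙ} {1ℙ} {0ℙ} ()
difference[a,b]≡difference[b,c]⇒a≡b {0ℙ} {1ℙ} {1ℙ} ()
difference[a,b]≡difference[b,c]⇒a≡b {1ℙ} {0ℙ} {0ℙ} ()
difference[a,b]≡difference[b,c]⇒a≡b {1ℙ} {0ℙ} {1ℙ} ()

Δ : InfWord Parity → InfWord Σ₃
Δ t n = difference (t n) (t (suc n))

-- The gap difference (t (i + j)) (t (i + n + j)) between the two halves is constant along the
-- square, and it must vanish because it cannot be ±1 twice in a row at j = 0 and j = n.
Δ-square⇒overlap : ∀ t i n → SquareAt (Δ t) i n → Overlap t i n
Δ-square⇒overlap t i n (_ , halves≡) j j≤n = difference≡1⇒≡ (begin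
  difference (t (i + j)) (t (i + n + j))  ≡⟨ gap-constant j j≤n ⟩
  difference (t i) (t (i + n))            ≡⟨ cong (difference (t i)) (sym tᵢ≡tᵢ₊ₙ) ⟩
  difference (t i) (t i)                  ≡⟨ difference-refl (t i) ⟩
  1F                                      ∎)
  where
  open ≡-Reasoning
  gap-constant : ∀ j → j ≤ n → difference (t (i + j)) (t (i + n + j)) ≡ difference (t i) (t (i + n))
  gap-constant zero    _   rewrite +-identityʳ i | +-identityʳ (i + n) = refl
  gap-constant (suc j) j<n rewrite +-suc i j | +-suc (i + n) j =
    trans (sym (difference-swap (halves≡ j j<n))) (gap-constant j (<⇒≤ j<n))
  tᵢ≡tᵢ₊ₙ : t i ≡ t (i + n)
  tᵢ≡tᵢ₊ₙ = difference[a,b]≡difference[b,c]⇒a≡b (sym (gap-constant n ≤-refl))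

Δ-a1a : ∀ t p → Δ t p ≡ Δ t (2 + p) → Δ t (1 + p) ≡ 1F → Δ t p ≡ 1F
Δ-a1a t p outer≡ middle≡1 = trans (cong (difference (t p)) (sym tₚ≡tₚ₊₁)) (difference-refl (t p))
  where
  tₚ≡tₚ₊₁ : t p ≡ t (1 + p)
  tₚ≡tₚ₊₁ = difference[a,b]≡difference[b,c]⇒a≡b
    (trans outer≡ (cong (λ a → difference a (t (3 + p))) (sym (difference≡1⇒≡ middle≡1))))

vtm : InfWord Σ₃
vtm = Δ thueMorse

vtm-squarefree : Squarefree vtm
vtm-squarefree i n square@(n>0 , _) =
  thueMorse-overlapFree n n>0 i (Δ-square⇒overlap thueMorse i n square)

vtm-≢suc : ∀ p → vtm p ≢ vtm (suc p)
vtm-≢suc = squarefree⇒≢suc {w = vtm} vtm-squarefree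

vtm-a1a : ∀ p → vtm p ≡ vtm (2 + p) → vtm (1 + p) ≢ 1F
vtm-a1a p outer≡ middle≡1 = vtm-≢suc p (trans (Δ-a1a thueMorse p outer≡ middle≡1) (sym middle≡1))

vtm-even≢1 : ∀ q → parity q ≡ 0ℙ → vtm q ≢ 1F
vtm-even≢1 q q-even vq≡1 =
  p≢p⁻¹ (thueMorse q) (trans (difference≡1⇒≡ vq≡1) (thueMorse-flip q q-even))

vtm-1ab1 : ∀ p → vtm p ≡ 1F → vtm (3 + p) ≢ 1F
vtm-1ab1 p first≡1 with parity[n]⊎parity[1+n]≡0ℙ p
... | inj₁ p-even   = λ _ → vtm-even≢1 p p-even first≡1
... | inj₂ 1+p-even = vtm-even≢1 (3 + p) 1+p-even

vtm-window : (i j : Fin 4) → i Fin.< j →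
  ∃ λ (k : Fin 4) → ∀ p → vtm (toℕ i + p) ≡ vtm (toℕ j + p) → vtm (toℕ k + p) ≢ 1F
vtm-window 0F 1F _ = 0F , λ p vᵢ≡vⱼ _ → vtm-≢suc p vᵢ≡vⱼ
vtm-window 1F 2F _ = 0F , λ p vᵢ≡vⱼ _ → vtm-≢suc (1 + p) vᵢ≡vⱼ
vtm-window 2F 3F _ = 0F , λ p vᵢ≡vⱼ _ → vtm-≢suc (2 + p) vᵢ≡vⱼ
vtm-window 0F 2F _ = 1F , vtm-a1a
vtm-window 1F 3F _ = 2F , λ p → vtm-a1a (1 + p)
vtm-window 0F 3F _ = 0F , λ p vᵢ≡vⱼ vᵢ≡1 → vtm-1ab1 p vᵢ≡1 (trans (sym vᵢ≡vⱼ) vᵢ≡1)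
vtm-window _                     0F ()
vtm-window (Fin.suc _)           1F (s≤s ())
vtm-window (Fin.suc (Fin.suc _)) 2F (s≤s (s≤s ()))
vtm-window 3F                    3F (s≤s (s≤s (s≤s ())))

transposed-vtm-avoids : (x : Fin 4 → Σ₃) →
  ∃ λ (π : Permutation′ 3) → ∀ p → ¬ (∀ l → π ⟨$⟩ʳ vtm (toℕ l + p) ≡ x l)
transposed-vtm-avoids x with pigeonhole (n<1+n 3) x
... | i , j , i<j , xᵢ≡xⱼ with vtm-window i j i<j
... | k , forbidden = π , λ p occurs → forbidden p
  (π-injective {vtm (toℕ i + p)} {vtm (toℕ j + p)} (trans (occurs i) (trans xᵢ≡xⱼ (sym (occurs j)))))
  (π-injective {vtm (toℕ k + p)} {1F} (occurs k))
  where
  π : Permutation′ 3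
  π = transpose 1F (x k)
  π-injective : Injective _≡_ _≡_ (π ⟨$⟩ʳ_)
  π-injective = Injection.injective (↔⇒↣ π)

occursAt⇒letter : ∀ (x : List A) w {p n} (n≤|x| : n ≤ length x) → OccursAt x w p →
  ∀ l → w (toℕ l + p) ≡ lookup x (inject≤ l n≤|x|)
occursAt⇒letter x w {p} n≤|x| occurs l =
  trans (cong w (trans (+-comm (toℕ l) p) (cong (p +_) (sym (toℕ-inject≤ l n≤|x|))))) (occurs _)

theorem3 : (x : List Σ₃) → length x ≥ 4 →
    ∃ λ (w : InfWord Σ₃) → Squarefree w × ¬ Occurs x w
theorem3 x |x|≥4 with transposed-vtm-avoids (λ l → lookup x (inject≤ l |x|≥4))
... | π , avoids =
  (π ⟨$⟩ʳ_) ∘ vtm ,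
  squarefree-map {w = vtm} (Injection.injective (↔⇒↣ π)) vtm-squarefree ,
  λ (p , occurs) → avoids p (occursAt⇒letter x ((π ⟨$⟩ʳ_) ∘ vtm) |x|≥4 occurs)
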